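{- Let $b \geq 2$ and $n \geq 2$ be integers, and define $m_{b,n} = b^n - b^2 + 3b - 3$ and $M_{b,n} = b^{n+1} - b^2 - (n-1)(b-1)^2 + (b - \lfloor b/2\rfloor)\lfloor b/2 \rfloor$ (and likewise $m_{b,n+1} = b^{n+1} - b^2 + 3b - 3$). For an integer $c \ge 0$ let $S_{[c,b]}:\mathbb{Z}^+\to\mathbb{Z}^+$ be defined by $S_{[c,b]}\left(\sum_{i=0}^k a_i b^i\right) = c + \sum_{i=0}^k a_i^2$ (base $b$ expansion, $0\le a_i\le b-1$, $a_k\ne0$). Then for every integer $c$ with $M_{b,n} < c < m_{b,n+1}$, the function $S_{[c,b]}$ has no fixed point; that is, these integers form a $k$-desert base $b$, where \[ k = m_{b,n+1} - M_{b,n} - 1 > (n - 5/4)(b-1)^2. \]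
   Context: A fixed point of $S_{[c,b]}$ is a positive integer $a$ with $S_{[c,b]}(a)=a$. For $k \in \mathbb{Z}^+$, a $k$-desert base $b$ is a set of $k$ consecutive non-negative integers $c$ such that for each of them $S_{[c,b]}$ has no fixed points. -}

module Defs where

open import Data.Nat as ℕ using (ℕ; zero; suc; _%_; NonZero)
open import Data.Integer as ℤ using (ℤ; +_; _-_; _*_; _^_)
open import Data.Product using (_×_)
open import Relation.Binary.PropositionalEquality using (_≡_)

-- Sum of squares of the base-b digits of a, computed with fuel.
-- With fuel ≥ a (we use fuel = a) this is exactly Σ a_i² over the
-- base-b expansion of a, since a / b < a for a > 0 and b ≥ 2.
digitSqSumFuel : (b : ℕ) → .{{NonZero b}} → ℕ → ℕ → ℕ
digitSqSumFuel b zero    a = 0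
digitSqSumFuel b (suc f) a = (a % b) ℕ.^ 2 ℕ.+ digitSqSumFuel b f (a ℕ./ b)

digitSqSum : (b : ℕ) → .{{NonZero b}} → ℕ → ℕ
digitSqSum b a = digitSqSumFuel b a a

S : (c b : ℕ) → .{{NonZero b}} → ℕ → ℕ
S c b a = c ℕ.+ digitSqSum b a

IsFixedPoint : (c b : ℕ) → .{{NonZero b}} → ℕ → Set
IsFixedPoint c b a = (0 ℕ.< a) × (S c b a ≡ a)

m : ℕ → ℕ → ℤ
m b n = (+ b) ^ n - (+ b) ^ 2 ℤ.+ (+ 3) * (+ b) - + 3

M : ℕ → ℕ → ℤ
M b n = (+ b) ^ (suc n) - (+ b) ^ 2 - (+ n - + 1) * (+ b - + 1) ^ 2
        ℤ.+ (+ b - + (b ℕ./ 2)) * + (b ℕ./ 2)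

{-# OPTIONS --safe #-}
-- Write a = Σ aᵢ bⁱ and D(a) = Σ aᵢ², so a − D(a) = Σ (bⁱ aᵢ − aᵢ²) and a is a fixed point of
-- S_[c,b] exactly when a − D(a) = c. Each term bⁱ aᵢ − aᵢ² is at most its maximum over digits,
-- and for a < b^(n+1) these maxima add up to M_{b,n}. For a ≥ b^(n+1) the digits above the units
-- digit contribute at least b^(n+1) − 1 (a digit r of weight t ≥ b gives t r − r² ≥ 0, the leading
-- one at least t − 1) and the units digit at least −(b − 1)(b − 2), so a − D(a) ≥ m_{b,n+1}. The length estimate only uses
-- 4 (b − h) h ≤ b², i.e. (b − 2h)² ≥ 0.
module Submission where

open import Defs
open import Data.Nat as ℕ using (ℕ; zero; suc; _≤_; _/_; _%_; NonZero; z≤n; s≤s)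
import Data.Nat.Properties as ℕ
open import Data.Nat.DivMod
  using (m≡m%n+[m/n]*n; m%n<n; m*n%n≡0; 0/n≡0; m/n<m; m<n*o⇒m/o<n; m*n/n≡m; /-monoˡ-≤;
         m<n⇒m%n≡m; m<n⇒m/n≡0; m≥n⇒m/n>0)
open import Data.Nat.Induction using (<-wellFounded)
open import Induction.WellFounded using (Acc; acc)
open import Data.Integer as ℤ using (ℤ; +_; -[1+_]; _+_; _<_; _-_; _*_; _^_; +≤+; 0ℤ; 1ℤ)
import Data.Integer.Properties as ℤ
open import Data.Integer.Tactic.RingSolver using (solve-∀)
open import Data.Product using (_×_; _,_)
open import Data.Sum using (_⊎_; inj₁; inj₂)
open import Relation.Nullary using (¬_; yes; no)
open import Relation.Binary.PropositionalEquality

≤-from-gap : ∀ {i j} d → 0ℤ ℤ.≤ d → j - i ≡ d → i ℤ.≤ j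
≤-from-gap d 0≤d j-i≡d = ℤ.0≤i-j⇒j≤i (subst (0ℤ ℤ.≤_) (sym j-i≡d) 0≤d)

0≤i*j : ∀ {i j} → 0ℤ ℤ.≤ i → 0ℤ ℤ.≤ j → 0ℤ ℤ.≤ i * j
0≤i*j {+ m} {+ n} _ _ = subst (0ℤ ℤ.≤_) (ℤ.pos-* m n) (+≤+ z≤n)

0≤i*i : ∀ i → 0ℤ ℤ.≤ i * i
0≤i*i (+ n)    = 0≤i*j {+ n} {+ n} (+≤+ z≤n) (+≤+ z≤n)
0≤i*i -[1+ n ] = +≤+ z≤n

0≤i*[i-1] : ∀ i → 0ℤ ℤ.≤ i * (i - 1ℤ)
0≤i*[i-1] (+ zero)  = +≤+ z≤n
0≤i*[i-1] (+ suc n) = 0≤i*j {+ suc n} {+ n} (+≤+ z≤n) (+≤+ z≤n)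
0≤i*[i-1] -[1+ n ]  = +≤+ z≤n

-- i − j and i − k never have opposite signs, since no integer lies strictly between j and k.
0≤[i-j]*[i-k] : ∀ i j {k} → k ≡ j ⊎ k ≡ j + 1ℤ → 0ℤ ℤ.≤ (i - j) * (i - k)
0≤[i-j]*[i-k] i j (inj₁ refl) = 0≤i*i (i - j)
0≤[i-j]*[i-k] i j (inj₂ refl) = subst (0ℤ ℤ.≤_) (shift i j) (0≤i*[i-1] (i - j))
  where
  shift : ∀ i j → (i - j) * ((i - j) - 1ℤ) ≡ (i - j) * (i - (j + 1ℤ))
  shift = solve-∀

i+j*j≤i*j+1 : ∀ {i j} → 1ℤ ℤ.≤ j → j < i → i + j * j ℤ.≤ i * j + 1ℤ
i+j*j≤i*j+1 {i} {j} 1≤j j<i =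
  ≤-from-gap ((j - 1ℤ) * (i - j - 1ℤ))
    (0≤i*j (ℤ.i≤j⇒0≤j-i 1≤j) (subst (0ℤ ℤ.≤_) (rearrange i j) (ℤ.i≤j⇒0≤j-i (ℤ.i<j⇒suc[i]≤j j<i))))
    (expand i j)
  where
  rearrange : ∀ i j → i - (1ℤ + j) ≡ i - j - 1ℤ
  rearrange = solve-∀
  expand : ∀ i j → i * j + 1ℤ - (i + j * j) ≡ (j - 1ℤ) * (i - j - 1ℤ)
  expand = solve-∀

toℤ-^ : ∀ m n → + (m ℕ.^ n) ≡ (+ m) ^ n
toℤ-^ m zero    = refl
toℤ-^ m (suc n) = trans (ℤ.pos-* m (m ℕ.^ n)) (cong ((+ m) *_) (toℤ-^ m n))

module DigitSquares (b : ℕ) .{{_ : NonZero b}} (2≤b : 2 ≤ b) where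

  B : ℤ
  B = + b

  D : ℕ → ℕ
  D = digitSqSum b

  a≤1+f⇒a/b≤f : ∀ {a f} → a ≤ suc f → a / b ≤ f
  a≤1+f⇒a/b≤f {zero}  _         = subst (_≤ _) (sym (0/n≡0 b)) z≤n
  a≤1+f⇒a/b≤f {suc a} (s≤s a≤f) = ℕ.≤-trans (ℕ.m<1+n⇒m≤n (m/n<m (suc a) b 2≤b)) a≤f

  digitSqSumFuel-0 : ∀ f → digitSqSumFuel b f 0 ≡ 0
  digitSqSumFuel-0 zero    = refl
  digitSqSumFuel-0 (suc f) =
    trans (cong₂ (λ r q → r ℕ.^ 2 ℕ.+ digitSqSumFuel b f q) (m*n%n≡0 0 b) (0/n≡0 b)) (digitSqSumFuel-0 f)

  digitSqSumFuel-stable : ∀ {f g a} → a ≤ f → a ≤ g → digitSqSumFuel b f a ≡ digitSqSumFuel b g a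
  digitSqSumFuel-stable {zero}  {g}     z≤n _   = sym (digitSqSumFuel-0 g)
  digitSqSumFuel-stable {suc f} {zero}  _   z≤n = digitSqSumFuel-0 (suc f)
  digitSqSumFuel-stable {suc f} {suc g} {a} a≤f a≤g =
    cong ((a % b) ℕ.^ 2 ℕ.+_) (digitSqSumFuel-stable (a≤1+f⇒a/b≤f a≤f) (a≤1+f⇒a/b≤f a≤g))

  digitSqSum-step : ∀ a → D a ≡ (a % b) ℕ.^ 2 ℕ.+ D (a / b)
  digitSqSum-step zero = cong₂ (λ r q → r ℕ.^ 2 ℕ.+ D q) (sym (m*n%n≡0 0 b)) (sym (0/n≡0 b))
  digitSqSum-step (suc a) =
    cong ((suc a % b) ℕ.^ 2 ℕ.+_) (digitSqSumFuel-stable (a≤1+f⇒a/b≤f ℕ.≤-refl) ℕ.≤-refl)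

  toℤ-divMod : ∀ a → + a ≡ + (a % b) + B * + (a / b)
  toℤ-divMod a = begin
    + a                            ≡⟨ cong +_ (m≡m%n+[m/n]*n a b) ⟩
    + (a % b ℕ.+ a / b ℕ.* b)      ≡⟨ ℤ.pos-+ (a % b) _ ⟩
    + (a % b) + + (a / b ℕ.* b)    ≡⟨ cong (λ x → + (a % b) + x) (ℤ.pos-* (a / b) b) ⟩
    + (a % b) + + (a / b) * B      ≡⟨ cong (λ x → + (a % b) + x) (ℤ.*-comm (+ (a / b)) B) ⟩
    + (a % b) + B * + (a / b)      ∎
    where open ≡-Reasoning

  toℤ-digitSqSum-step : ∀ a → + D a ≡ + (a % b) * + (a % b) + + D (a / b)
  toℤ-digitSqSum-step a = begin
    + D a                                  ≡⟨ cong +_ (digitSqSum-step a) ⟩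
    + ((a % b) ℕ.^ 2 ℕ.+ D (a / b))        ≡⟨ ℤ.pos-+ ((a % b) ℕ.^ 2) _ ⟩
    + ((a % b) ℕ.^ 2) + + D (a / b)        ≡⟨ cong (λ x → x + + D (a / b)) (toℤ-^ (a % b) 2) ⟩
    (+ (a % b)) ^ 2 + + D (a / b)          ≡⟨ cong (λ x → + (a % b) * x + + D (a / b)) (ℤ.*-identityʳ _) ⟩
    + (a % b) * + (a % b) + + D (a / b)    ∎
    where open ≡-Reasoning

  toℤ-digitSqSum-digit : ∀ {r} → r ℕ.< b → + D r ≡ + r * + r
  toℤ-digitSqSum-digit {r} r<b
    rewrite toℤ-digitSqSum-step r | m<n⇒m%n≡m r<b | m<n⇒m/n≡0 r<b = ℤ.+-identityʳ (+ r * + r)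

  0≤b-1-r : ∀ {r} → r ℕ.< b → 0ℤ ℤ.≤ B - 1ℤ - + r
  0≤b-1-r {r} r<b = subst (0ℤ ℤ.≤_) (rearrange B (+ r)) (ℤ.i≤j⇒0≤j-i (+≤+ r<b))
    where
    rearrange : ∀ b r → b - (1ℤ + r) ≡ b - 1ℤ - r
    rearrange = solve-∀

  H : ℤ
  H = + (b / 2)

  b-h≡h⊎b-h≡h+1 : B - H ≡ H ⊎ B - H ≡ H + 1ℤ
  b-h≡h⊎b-h≡h+1 with b % 2 | m%n<n b 2 | m≡m%n+[m/n]*n b 2
  ... | 0           | _               | b≡h*2   = inj₁ (begin
    B - H                  ≡⟨ cong (λ x → + x - H) b≡h*2 ⟩
    + (b / 2 ℕ.* 2) - H    ≡⟨ cong (_- H) (ℤ.pos-* (b / 2) 2) ⟩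
    H * + 2 - H            ≡⟨ double-minus H ⟩
    H                      ∎)
    where
    open ≡-Reasoning
    double-minus : ∀ h → h * + 2 - h ≡ h
    double-minus = solve-∀
  ... | 1           | _               | b≡1+h*2 = inj₂ (begin
    B - H                        ≡⟨ cong (λ x → + x - H) b≡1+h*2 ⟩
    + (1 ℕ.+ b / 2 ℕ.* 2) - H    ≡⟨ cong (λ x → 1ℤ + x - H) (ℤ.pos-* (b / 2) 2) ⟩
    1ℤ + H * + 2 - H             ≡⟨ double-minus H ⟩
    H + 1ℤ                       ∎)
    where
    open ≡-Reasoning
    double-minus : ∀ h → 1ℤ + h * + 2 - h ≡ h + 1ℤ
    double-minus = solve-∀
  ... | suc (suc _) | s≤s (s≤s ()) | _

  -- The maximum of bⁱ r − r² over digits r, attained at r = 0, r = ⌊b/2⌋ and r = b − 1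
  -- for i = 0, i = 1 and i ≥ 2 respectively.
  maxDigitGain : ℕ → ℤ
  maxDigitGain 0             = 0ℤ
  maxDigitGain 1             = (B - H) * H
  maxDigitGain (suc (suc l)) = (B - 1ℤ) * (B ^ suc (suc l) - B + 1ℤ)

  1≤b^l : ∀ l → 1ℤ ℤ.≤ B ^ l
  1≤b^l l = subst (1ℤ ℤ.≤_) (toℤ-^ b l) (+≤+ (ℕ.m^n>0 b l))

  digitGain≤maxDigitGain : ∀ i {r} → r ℕ.< b → B ^ i * + r ℤ.≤ + r * + r + maxDigitGain i
  digitGain≤maxDigitGain 0 {r} _ = ≤-from-gap (+ r * (+ r - 1ℤ)) (0≤i*[i-1] (+ r)) (gap (+ r))
    where
    gap : ∀ r → r * r + 0ℤ - 1ℤ * r ≡ r * (r - 1ℤ)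
    gap = solve-∀
  digitGain≤maxDigitGain 1 {r} _ =
    ≤-from-gap ((+ r - H) * (+ r - (B - H))) (0≤[i-j]*[i-k] (+ r) H b-h≡h⊎b-h≡h+1) (gap B H (+ r))
    where
    gap : ∀ b h r → r * r + (b - h) * h - b * 1ℤ * r ≡ (r - h) * (r - (b - h))
    gap = solve-∀
  digitGain≤maxDigitGain (suc (suc l)) {r} r<b =
    ≤-from-gap ((B - 1ℤ - + r) * (B ^ suc (suc l) - B + 1ℤ - + r))
      (0≤i*j (0≤b-1-r r<b) 0≤b^[2+l]-b+1-r) (gap B (+ r) (B ^ l))
    where
    -- solve-∀ does not handle _^_, so powers are unfolded (here x stands for B ^ l).
    gap : ∀ b r x → r * r + (b - 1ℤ) * (b * (b * x) - b + 1ℤ) - b * (b * x) * r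
                    ≡ (b - 1ℤ - r) * (b * (b * x) - b + 1ℤ - r)
    gap = solve-∀
    split : ∀ b r x → b * b * (x - 1ℤ) + (b - 1ℤ) * (b - 1ℤ) + (b - 1ℤ - r) + 1ℤ
                      ≡ b * (b * x) - b + 1ℤ - r
    split = solve-∀
    0≤b^[2+l]-b+1-r : 0ℤ ℤ.≤ B ^ suc (suc l) - B + 1ℤ - + r
    0≤b^[2+l]-b+1-r = subst (0ℤ ℤ.≤_) (split B (+ r) (B ^ l))
      (ℤ.+-mono-≤ (ℤ.+-mono-≤ (ℤ.+-mono-≤ (0≤i*j (0≤i*i B) (ℤ.i≤j⇒0≤j-i (1≤b^l l)))
                                          (0≤i*i (B - 1ℤ)))
                              (0≤b-1-r r<b))
                  (+≤+ z≤n))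

  maxDigitGainSum : ℕ → ℕ → ℤ
  maxDigitGainSum i zero    = 0ℤ
  maxDigitGainSum i (suc j) = maxDigitGain i + maxDigitGainSum (suc i) j

  maxDigitGainSum-snoc : ∀ i j → maxDigitGainSum i (suc j) ≡ maxDigitGainSum i j + maxDigitGain (i ℕ.+ j)
  maxDigitGainSum-snoc i zero    rewrite ℕ.+-identityʳ i = ℤ.+-comm (maxDigitGain i) 0ℤ
  maxDigitGainSum-snoc i (suc j) rewrite maxDigitGainSum-snoc (suc i) j | ℕ.+-suc i j =
    sym (ℤ.+-assoc (maxDigitGain i) (maxDigitGainSum (suc i) j) (maxDigitGain (suc (i ℕ.+ j))))

  maxDigitGainSum≡M : ∀ k → maxDigitGainSum 0 (2 ℕ.+ k) ≡ M b (suc k)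
  maxDigitGainSum≡M zero    = first-two B H
    where
    first-two : ∀ b h → 0ℤ + ((b - h) * h + 0ℤ)
                        ≡ b * (b * 1ℤ) - b * (b * 1ℤ) - (1ℤ - 1ℤ) * ((b - 1ℤ) * ((b - 1ℤ) * 1ℤ)) + (b - h) * h
    first-two = solve-∀
  maxDigitGainSum≡M (suc k) = begin
    maxDigitGainSum 0 (3 ℕ.+ k)                             ≡⟨ maxDigitGainSum-snoc 0 (2 ℕ.+ k) ⟩
    maxDigitGainSum 0 (2 ℕ.+ k) + maxDigitGain (2 ℕ.+ k)    ≡⟨ cong (_+ maxDigitGain (2 ℕ.+ k)) (maxDigitGainSum≡M k) ⟩
    M b (suc k) + maxDigitGain (2 ℕ.+ k)                    ≡⟨ next-term B H (+ suc k) (B ^ k) ⟩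
    M b (2 ℕ.+ k)                                           ∎
    where
    open ≡-Reasoning
    next-term : ∀ b h n x →
      (b * (b * x) - b * (b * 1ℤ) - (n - 1ℤ) * ((b - 1ℤ) * ((b - 1ℤ) * 1ℤ)) + (b - h) * h)
        + (b - 1ℤ) * (b * (b * x) - b + 1ℤ)
      ≡ b * (b * (b * x)) - b * (b * 1ℤ) - ((1ℤ + n) - 1ℤ) * ((b - 1ℤ) * ((b - 1ℤ) * 1ℤ)) + (b - h) * h
    next-term = solve-∀

  weighted≤digitSqSum+gains : ∀ j i {a} → a ℕ.< b ℕ.^ j → B ^ i * + a ℤ.≤ + D a + maxDigitGainSum i j
  weighted≤digitSqSum+gains zero    i {zero}  _            = ℤ.≤-reflexive (ℤ.*-zeroʳ (B ^ i))
  weighted≤digitSqSum+gains zero    i {suc a} (s≤s ())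
  weighted≤digitSqSum+gains (suc j) i {a} a<b^[1+j] = begin
    B ^ i * + a
      ≡⟨ cong (B ^ i *_) (toℤ-divMod a) ⟩
    B ^ i * (R + B * Q)
      ≡⟨ distrib (B ^ i) B R Q ⟩
    B ^ i * R + B ^ suc i * Q
      ≤⟨ ℤ.+-mono-≤ (digitGain≤maxDigitGain i (m%n<n a b)) (weighted≤digitSqSum+gains j (suc i) q<b^j) ⟩
    (R * R + maxDigitGain i) + (+ D q + maxDigitGainSum (suc i) j)
      ≡⟨ interchange (R * R) (maxDigitGain i) (+ D q) (maxDigitGainSum (suc i) j) ⟩
    (R * R + + D q) + maxDigitGainSum i (suc j)
      ≡⟨ cong (_+ maxDigitGainSum i (suc j)) (toℤ-digitSqSum-step a) ⟨
    + D a + maxDigitGainSum i (suc j)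
      ∎
    where
    open ℤ.≤-Reasoning
    q = a / b
    R = + (a % b)
    Q = + q
    q<b^j : q ℕ.< b ℕ.^ j
    q<b^j = m<n*o⇒m/o<n (subst (a ℕ.<_) (ℕ.*-comm b (b ℕ.^ j)) a<b^[1+j])
    distrib : ∀ p b r q → p * (r + b * q) ≡ p * r + b * p * q
    distrib = solve-∀
    interchange : ∀ w x y z → (w + x) + (y + z) ≡ (w + y) + (x + z)
    interchange = solve-∀

  a≤digitSqSum+M : ∀ k {a} → a ℕ.< b ℕ.^ (2 ℕ.+ k) → + a ℤ.≤ + D a + M b (suc k)
  a≤digitSqSum+M k {a} a<b^[2+k] =
    subst₂ ℤ._≤_ (ℤ.*-identityˡ (+ a)) (cong (λ x → + D a + x) (maxDigitGainSum≡M k))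
      (weighted≤digitSqSum+gains (2 ℕ.+ k) 0 a<b^[2+k])

  b≤t⇒b≤t*b : ∀ {t} → b ≤ t → b ≤ t ℕ.* b
  b≤t⇒b≤t*b {t} b≤t = ℕ.≤-trans b≤t (ℕ.m≤m*n t b)

  b≤t⇒q%b≤t : ∀ q {t} → b ≤ t → q % b ≤ t
  b≤t⇒q%b≤t q b≤t = ℕ.<⇒≤ (ℕ.<-≤-trans (m%n<n q b) b≤t)

  b^[1+n]≤q⇒b^n≤q/b : ∀ n {q} → b ℕ.^ suc n ≤ q → b ℕ.^ n ≤ q / b
  b^[1+n]≤q⇒b^n≤q/b n {q} b^[1+n]≤q =
    subst (_≤ q / b) (m*n/n≡m (b ℕ.^ n) b) (/-monoˡ-≤ b (subst (_≤ q) (ℕ.*-comm b (b ℕ.^ n)) b^[1+n]≤q))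

  -- The units digit r of q contributes t r − r² ≥ 0; the digits of q / b then carry weight t b.
  peel-digit : ∀ {q t} w → q % b ≤ t →
               w + + D (q / b) ℤ.≤ + (t ℕ.* b) * + (q / b) + 1ℤ →
               w + + D q ℤ.≤ + t * + q + 1ℤ
  peel-digit {q} {t} w r≤t w+D[q/b]≤ = begin
    w + + D q                         ≡⟨ cong (λ x → w + x) (toℤ-digitSqSum-step q) ⟩
    w + (R * R + E)                   ≤⟨ ℤ.+-monoʳ-≤ w (ℤ.+-monoˡ-≤ E (ℤ.*-monoʳ-≤-nonNeg R (+≤+ r≤t))) ⟩
    w + (T * R + E)                   ≡⟨ swap w (T * R) E ⟩
    T * R + (w + E)                   ≤⟨ ℤ.+-monoʳ-≤ (T * R) w+D[q/b]≤ ⟩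
    T * R + (+ (t ℕ.* b) * Q + 1ℤ)    ≡⟨ cong (λ x → T * R + (x * Q + 1ℤ)) (ℤ.pos-* t b) ⟩
    T * R + (T * B * Q + 1ℤ)          ≡⟨ factor T R B Q ⟩
    T * (R + B * Q) + 1ℤ              ≡⟨ cong (λ x → T * x + 1ℤ) (toℤ-divMod q) ⟨
    T * + q + 1ℤ                      ∎
    where
    open ℤ.≤-Reasoning
    R = + (q % b)
    Q = + (q / b)
    T = + t
    E = + D (q / b)
    swap : ∀ w x e → w + (x + e) ≡ x + (w + e)
    swap = solve-∀
    factor : ∀ t r b q → t * r + (t * b * q + 1ℤ) ≡ t * (r + b * q) + 1ℤ
    factor = solve-∀

  t+digitSqSum≤t*q+1 : ∀ {q} t → 1 ≤ q → b ≤ t → + t + + D q ℤ.≤ + t * + q + 1ℤ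
  t+digitSqSum≤t*q+1 {q} t = go t (<-wellFounded q)
    where
    go : ∀ {q} t → Acc ℕ._<_ q → 1 ≤ q → b ≤ t → + t + + D q ℤ.≤ + t * + q + 1ℤ
    go {q} t (acc smaller) 1≤q b≤t with q ℕ.<? b
    ... | yes q<b = subst (λ x → + t + x ℤ.≤ + t * + q + 1ℤ) (sym (toℤ-digitSqSum-digit q<b))
                      (i+j*j≤i*j+1 (+≤+ 1≤q) (ℤ.+<+ (ℕ.<-≤-trans q<b b≤t)))
    ... | no q≮b = peel-digit (+ t) (b≤t⇒q%b≤t q b≤t)
                     (ℤ.≤-trans (ℤ.+-monoˡ-≤ (+ D (q / b)) (+≤+ (ℕ.m≤m*n t b)))
                                (go (t ℕ.* b) (smaller q/b<q) (m≥n⇒m/n>0 b≤q) (b≤t⇒b≤t*b b≤t)))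
      where
      instance _ = ℕ.>-nonZero 1≤q
      b≤q = ℕ.≮⇒≥ q≮b
      q/b<q = m/n<m q b 2≤b

  t*b^n+digitSqSum≤t*q+1 : ∀ n {q} t → b ℕ.^ n ≤ q → b ≤ t → + t * B ^ n + + D q ℤ.≤ + t * + q + 1ℤ
  t*b^n+digitSqSum≤t*q+1 zero {q} t 1≤q b≤t =
    subst (λ x → x + + D q ℤ.≤ + t * + q + 1ℤ) (sym (ℤ.*-identityʳ (+ t))) (t+digitSqSum≤t*q+1 t 1≤q b≤t)
  t*b^n+digitSqSum≤t*q+1 (suc n) {q} t b^[1+n]≤q b≤t =
    peel-digit (+ t * B ^ suc n) (b≤t⇒q%b≤t q b≤t)
      (subst (λ x → x + + D (q / b) ℤ.≤ + (t ℕ.* b) * + (q / b) + 1ℤ) rescale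
        (t*b^n+digitSqSum≤t*q+1 n (t ℕ.* b) (b^[1+n]≤q⇒b^n≤q/b n b^[1+n]≤q) (b≤t⇒b≤t*b b≤t)))
    where
    rescale : + (t ℕ.* b) * B ^ n ≡ + t * B ^ suc n
    rescale = trans (cong (_* B ^ n) (ℤ.pos-* t b)) (ℤ.*-assoc (+ t) B (B ^ n))

  digitSqSum+m≤a : ∀ n {a} → b ℕ.^ suc n ≤ a → + D a + m b (suc n) ℤ.≤ + a
  digitSqSum+m≤a n {a} b^[1+n]≤a = ≤-from-gap (higher + units) (ℤ.+-mono-≤ 0≤higher 0≤units) split
    where
    R = + (a % b)
    Q = + (a / b)
    E = + D (a / b)
    higher : ℤ
    higher = B * Q + 1ℤ - (B * B ^ n + E)
    units : ℤ
    units = (B - 1ℤ - R) * (B - + 2 + R)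
    0≤higher : 0ℤ ℤ.≤ higher
    0≤higher = ℤ.i≤j⇒0≤j-i (t*b^n+digitSqSum≤t*q+1 n b (b^[1+n]≤q⇒b^n≤q/b n b^[1+n]≤a) ℕ.≤-refl)
    0≤units : 0ℤ ℤ.≤ units
    0≤units = 0≤i*j (0≤b-1-r (m%n<n a b)) (ℤ.+-mono-≤ (ℤ.i≤j⇒0≤j-i (+≤+ 2≤b)) (+≤+ z≤n))
    gap : ∀ b r q x e → (r + b * q) - ((r * r + e) + (b * x - b * (b * 1ℤ) + + 3 * b - + 3))
                        ≡ (b * q + 1ℤ - (b * x + e)) + (b - 1ℤ - r) * (b - + 2 + r)
    gap = solve-∀
    split : + a - (+ D a + m b (suc n)) ≡ higher + units
    split = begin
      + a - (+ D a + m b (suc n))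
        ≡⟨ cong₂ (λ x y → x - (y + m b (suc n))) (toℤ-divMod a) (toℤ-digitSqSum-step a) ⟩
      (R + B * Q) - ((R * R + E) + m b (suc n))
        ≡⟨ gap B R Q (B ^ n) E ⟩
      higher + units
        ∎
      where open ≡-Reasoning

  fixedPoint⇒a≡D[a]+c : ∀ {c a} → IsFixedPoint c b a → + a ≡ + D a + + c
  fixedPoint⇒a≡D[a]+c {c} {a} (_ , c+Da≡a) = cong +_ (trans (sym c+Da≡a) (ℕ.+-comm c (D a)))

desert-length-bound : ∀ b n → 2 ≤ b →
  (+ b - + 1) ^ 2 * (+ 4 * + n - + 5) < + 4 * (m b (suc n) - M b n - + 1)
desert-length-bound b n 2≤b = ℤ.suc[i]≤j⇒i<j (≤-from-gap
  ((B - + 2 * H) * (B - + 2 * H) + + 10 * (B - + 2) + + 4)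
  (ℤ.+-mono-≤ (ℤ.+-mono-≤ (0≤i*i (B - + 2 * H)) 0≤10[b-2]) (+≤+ z≤n))
  (gap B H (+ n) (B ^ n)))
  where
  B = + b
  H = + (b / 2)
  0≤10[b-2] : 0ℤ ℤ.≤ + 10 * (B - + 2)
  0≤10[b-2] = 0≤i*j {+ 10} (+≤+ z≤n) (ℤ.i≤j⇒0≤j-i (+≤+ 2≤b))
  gap : ∀ b h n x →
    + 4 * ((b * x - b * (b * 1ℤ) + + 3 * b - + 3)
           - (b * x - b * (b * 1ℤ) - (n - 1ℤ) * ((b - 1ℤ) * ((b - 1ℤ) * 1ℤ)) + (b - h) * h) - 1ℤ)
      - (1ℤ + (b - 1ℤ) * ((b - 1ℤ) * 1ℤ) * (+ 4 * n - + 5))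
    ≡ (b - + 2 * h) * (b - + 2 * h) + + 10 * (b - + 2) + + 4
  gap = solve-∀

lemma4p3 : (b n : ℕ) → .{{_ : NonZero b}} → 2 ≤ b → 2 ≤ n →
    ((c : ℕ) → M b n < + c → + c < m b (suc n) →
      (a : ℕ) → ¬ IsFixedPoint c b a)
    × ((+ b - + 1) ^ 2 * (+ 4 * + n - + 5)
        < + 4 * (m b (suc n) - M b n - + 1))
lemma4p3 b (suc k) 2≤b _ = no-fixed-point , desert-length-bound b (suc k) 2≤b
  where
  open DigitSquares b 2≤b
  no-fixed-point : ∀ c → M b (suc k) < + c → + c < m b (2 ℕ.+ k) → ∀ a → ¬ IsFixedPoint c b a
  no-fixed-point c M<c c<m a fp with a ℕ.<? b ℕ.^ (2 ℕ.+ k)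
  ... | yes a<b^[2+k] = ℤ.<⇒≱ (ℤ.+-monoʳ-< (+ D a) M<c)
    (subst (ℤ._≤ + D a + M b (suc k)) (fixedPoint⇒a≡D[a]+c fp) (a≤digitSqSum+M k a<b^[2+k]))
  ... | no a≮b^[2+k]  = ℤ.<⇒≱ (ℤ.+-monoʳ-< (+ D a) c<m)
    (subst (+ D a + m b (2 ℕ.+ k) ℤ.≤_) (fixedPoint⇒a≡D[a]+c fp) (digitSqSum+m≤a (suc k) (ℕ.≮⇒≥ a≮b^[2+k])))
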